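{- For any graph $G$ of order $n\geqslant 5$, $n\leqslant \chi_i(G)\chi_i(\overline{G})\leqslant n^2$, where $\overline{G}$ is the complement of $G$.
   Context: All graphs are finite and simple; the order of a graph is its number of vertices, and $\overline{G}$ denotes the complement of $G$. A mapping $f:V(G)\to\{1,\ldots,k\}$ is an injective $k$-coloring of $G$ if $f(u)\neq f(v)$ whenever the distinct vertices $u$ and $v$ have a common neighbor in $G$ (adjacent vertices without a common neighbor may receive the same color). The injective chromatic number $\chi_i(G)$ is the minimum $k$ such that $G$ has an injective $k$-coloring. -}

module Defs where

open import Data.Nat using (ℕ; _≤_)
open import Data.Fin using (Fin; _≟_)
open import Data.Bool using (Bool; true; false; not; _∧_)
open import Data.Product using (Σ; _×_; ∃-syntax)
open import Relation.Nullary using (¬_)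
open import Relation.Nullary.Decidable using (⌊_⌋)
open import Relation.Binary.PropositionalEquality using (_≡_)

record Graph (n : ℕ) : Set where
  field
    adj     : Fin n → Fin n → Bool
    symm    : ∀ u v → adj u v ≡ adj v u
    irrefl  : ∀ v → adj v v ≡ false
open Graph public

complement : ∀ {n} → Graph n → Graph n
complement {n} G = record
  { adj = λ u v → not ⌊ u ≟ v ⌋ ∧ not (adj G u v)
  ; symm = sym'
  ; irrefl = irr
  }
  where
  open import Relation.Nullary using (yes; no)
  open import Relation.Binary.PropositionalEquality using (refl; sym; cong)
  open import Data.Empty using (⊥-elim)
  sym' : ∀ u v → (not ⌊ u ≟ v ⌋ ∧ not (adj G u v)) ≡ (not ⌊ v ≟ u ⌋ ∧ not (adj G v u))
  sym' u v with u ≟ v | v ≟ u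
  ... | yes _ | yes _ = refl
  ... | yes p | no q = ⊥-elim (q (sym p))
  ... | no q | yes p = ⊥-elim (q (sym p))
  ... | no _ | no _ = cong not (symm G u v)
  irr : ∀ v → (not ⌊ v ≟ v ⌋ ∧ not (adj G v v)) ≡ false
  irr v with v ≟ v
  ... | yes _ = refl
  ... | no q = ⊥-elim (q refl)

CommonNeighbour : ∀ {n} → Graph n → Fin n → Fin n → Set
CommonNeighbour G u v = ∃[ w ] (adj G u w ≡ true × adj G v w ≡ true)

IsInjectiveColoring : ∀ {n} (G : Graph n) (k : ℕ) → (Fin n → Fin k) → Set
IsInjectiveColoring G k f =
  ∀ u v → ¬ (u ≡ v) → CommonNeighbour G u v → ¬ (f u ≡ f v)

HasInjectiveColoring : ∀ {n} → Graph n → ℕ → Set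
HasInjectiveColoring {n} G k = Σ (Fin n → Fin k) (IsInjectiveColoring G k)

IsInjectiveChromaticNumber : ∀ {n} → Graph n → ℕ → Set
IsInjectiveChromaticNumber G k =
  HasInjectiveColoring G k × (∀ m → HasInjectiveColoring G m → k ≤ m)

-- The upper bound holds because the identity map is an injective colouring of
-- any graph, so χᵢ(G) ≤ n and χᵢ(Ḡ) ≤ n.
--
-- For the lower bound take optimal injective colourings f of G (a colours) and
-- g of Ḡ (b colours).  If n > a · b, the pigeonhole principle yields distinct
-- vertices u, v with f u = f v and g u = g v, so u, v have no common neighbour
-- in G nor in Ḡ.  Say uv is an edge of G (otherwise exchange G and Ḡ).  Then
-- every vertex outside {u, v} is adjacent in G to exactly one of u, v; since
-- n ≥ 5, two such vertices lie on the same side and so receive two different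
-- colours c₁ ≠ c₂ under g.  Labelling each vertex w by (f w, c₁ or c₂
-- according to whether w ~ u in G) is then injective, hence n ≤ a · b anyway.
-- The argument only uses that every pair of distinct vertices is adjacent in
-- G or in Ḡ, so it is carried out for any two graphs covering all pairs.
module Submission where

open import Data.Bool using (Bool; true; false; if_then_else_)
open import Data.Empty using (⊥-elim)
open import Data.Fin using (Fin; zero; suc; _≟_; _↑ˡ_; combine; punchIn; punchOut)
open import Data.Fin.Properties
  using (combine-injective; punchIn-injective; punchInᵢ≢i; punchIn-punchOut; ↑ˡ-injective;
         injective⇒≤; pigeonhole; <⇒≢)
open import Data.Nat using (ℕ; _+_; _≤_; _*_; s≤s; _≤?_)
open import Data.Nat.Properties using (*-mono-≤; *-comm; ≤-trans; ≤-reflexive; ≰⇒>)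
open import Data.Product using (Σ; _×_; _,_; ∃-syntax)
open import Function using (_∘_)
open import Relation.Nullary using (¬_; yes; no; contradiction)
open import Relation.Binary.PropositionalEquality using (_≡_; _≢_; refl; sym; trans)

open import Defs

bool-pigeonhole : (h : Fin 3 → Bool) → ∃[ i ] ∃[ j ] i ≢ j × h i ≡ h j
bool-pigeonhole h with h zero in e₀ | h (suc zero) in e₁ | h (suc (suc zero)) in e₂
... | true  | true  | _     = zero , suc zero , (λ ()) , trans e₀ (sym e₁)
... | false | false | _     = zero , suc zero , (λ ()) , trans e₀ (sym e₁)
... | true  | false | true  = zero , suc (suc zero) , (λ ()) , trans e₀ (sym e₂)
... | false | true  | false = zero , suc (suc zero) , (λ ()) , trans e₀ (sym e₂)
... | true  | false | false = suc zero , suc (suc zero) , (λ ()) , trans e₁ (sym e₂)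
... | false | true  | true  = suc zero , suc (suc zero) , (λ ()) , trans e₁ (sym e₂)

if-injective : ∀ {A : Set} {x y : A} → x ≢ y → ∀ {p q : Bool}
  → (if p then x else y) ≡ (if q then x else y) → p ≡ q
if-injective x≢y {true}  {true}  _   = refl
if-injective x≢y {true}  {false} x≡y = contradiction x≡y x≢y
if-injective x≢y {false} {true}  y≡x = contradiction (sym y≡x) x≢y
if-injective x≢y {false} {false} _   = refl

module SkipTwo {m : ℕ} {u v : Fin (2 + m)} (u≢v : u ≢ v) where

  skip : Fin m → Fin (2 + m)
  skip j = punchIn u (punchIn (punchOut u≢v) j)

  skip-injective : ∀ {i j} → i ≢ j → skip i ≢ skip j
  skip-injective i≢j eq =
    i≢j (punchIn-injective (punchOut u≢v) _ _ (punchIn-injective u _ _ eq))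

  skip≢u : ∀ j → skip j ≢ u
  skip≢u j = punchInᵢ≢i u _

  skip≢v : ∀ j → skip j ≢ v
  skip≢v j eq = punchInᵢ≢i (punchOut u≢v) j
    (punchIn-injective u _ _ (trans eq (sym (punchIn-punchOut u≢v))))

three-outside : ∀ {n} → 5 ≤ n → {u v : Fin n} → u ≢ v
  → Σ (Fin 3 → Fin n) λ t → (∀ {i j} → i ≢ j → t i ≢ t j) × (∀ i → t i ≢ u) × (∀ i → t i ≢ v)
three-outside (s≤s (s≤s (s≤s (s≤s (s≤s {n = k} _))))) u≢v =
  skip ∘ (_↑ˡ k) ,
  (λ i≢j → skip-injective (i≢j ∘ ↑ˡ-injective k _ _)) ,
  (λ i → skip≢u (i ↑ˡ k)) ,
  (λ i → skip≢v (i ↑ˡ k))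
  where open SkipTwo u≢v

flip-adj : ∀ {n} (G : Graph n) {x y} → adj G x y ≡ true → adj G y x ≡ true
flip-adj G {x} {y} Gxy = trans (symm G y x) Gxy

same-colour⇒no-common-neighbour : ∀ {n k} {G : Graph n} {f : Fin n → Fin k}
  → IsInjectiveColoring G k f → ∀ {u v} → u ≢ v → f u ≡ f v → ¬ CommonNeighbour G u v
same-colour⇒no-common-neighbour f-ok u≢v fu≡fv common = f-ok _ _ u≢v common fu≡fv

identity-colouring : ∀ {n} (G : Graph n) → HasInjectiveColoring G n
identity-colouring G = (λ x → x) , λ u v u≢v _ u≡v → u≢v u≡v

Covers : ∀ {n} → Graph n → Graph n → Set
Covers G H = ∀ x y → x ≢ y → adj G x y ≡ false → adj H x y ≡ true

complement-covers : ∀ {n} (G : Graph n) → Covers G (complement G)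
complement-covers G x y x≢y Gxy with x ≟ y
... | yes x≡y = contradiction x≡y x≢y
... | no _ rewrite Gxy = refl

covers-complement : ∀ {n} (G : Graph n) → Covers (complement G) G
covers-complement G x y x≢y Ḡxy with x ≟ y
... | yes x≡y = contradiction x≡y x≢y
... | no _ with adj G x y
...   | true  = refl
...   | false = contradiction Ḡxy λ ()

module AdjacentTwins {n a b : ℕ} (G H : Graph n) (cover : Covers G H)
  {f : Fin n → Fin a} (f-ok : IsInjectiveColoring G a f)
  {g : Fin n → Fin b} (g-ok : IsInjectiveColoring H b g)
  {u v : Fin n} (u≢v : u ≢ v) (Guv : adj G u v ≡ true)
  (¬G-common : ¬ CommonNeighbour G u v) (¬H-common : ¬ CommonNeighbour H u v) where

  neighbour-of-u⇒non-neighbour-of-v : ∀ w → adj G u w ≡ true → adj G v w ≡ false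
  neighbour-of-u⇒non-neighbour-of-v w Guw with adj G v w in Gvw
  ... | true  = ⊥-elim (¬G-common (w , Guw , Gvw))
  ... | false = refl

  -- A vertex not adjacent to u in G is adjacent to v in G: otherwise it
  -- would be a common H-neighbour of u and v.
  non-neighbour-of-u⇒neighbour-of-v : ∀ w → adj G u w ≡ false → adj G v w ≡ true
  non-neighbour-of-u⇒neighbour-of-v w Guw with w ≟ u
  ... | yes refl = flip-adj G Guv
  ... | no w≢u with w ≟ v
  ...   | yes refl = contradiction (trans (sym Guv) Guw) λ ()
  ...   | no w≢v with adj G v w in Gvw
  ...     | true  = refl
  ...     | false = ⊥-elim (¬H-common (w , cover u w (w≢u ∘ sym) Guw , cover v w (w≢v ∘ sym) Gvw))

  -- Distinct vertices with the same f-colour lie on different sides of u: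
  -- otherwise u or v would be a common G-neighbour.
  same-colour⇒separated-by-u : ∀ {w w'} → w ≢ w' → f w ≡ f w' → adj G u w ≢ adj G u w'
  same-colour⇒separated-by-u {w} {w'} w≢w' fw≡fw' same with adj G u w in Guw | adj G u w' in Guw'
  ... | true  | true  = f-ok w w' w≢w' (u , flip-adj G Guw , flip-adj G Guw') fw≡fw'
  ... | false | false = f-ok w w' w≢w'
        (v , flip-adj G (non-neighbour-of-u⇒neighbour-of-v w Guw)
           , flip-adj G (non-neighbour-of-u⇒neighbour-of-v w' Guw')) fw≡fw'
  ... | true  | false = contradiction same λ ()
  ... | false | true  = contradiction same λ ()

  -- Distinct vertices outside {u, v} on the same side of u get different
  -- g-colours: they share the H-neighbour v (if adjacent to u in G) or u (if not).
  same-side⇒distinct-H-colours : ∀ {x y} → x ≢ y → x ≢ u → x ≢ v → y ≢ u → y ≢ v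
    → adj G u x ≡ adj G u y → g x ≢ g y
  same-side⇒distinct-H-colours {x} {y} x≢y x≢u x≢v y≢u y≢v same
    with adj G u x in Gux | adj G u y in Guy
  ... | true  | true  = g-ok x y x≢y (v , H-neighbour-of-v Gux x≢v , H-neighbour-of-v Guy y≢v)
    where
    H-neighbour-of-v : ∀ {z} → adj G u z ≡ true → z ≢ v → adj H z v ≡ true
    H-neighbour-of-v {z} Guz z≢v =
      flip-adj H (cover v z (z≢v ∘ sym) (neighbour-of-u⇒non-neighbour-of-v z Guz))
  ... | false | false = g-ok x y x≢y
        (u , flip-adj H (cover u x (x≢u ∘ sym) Gux) , flip-adj H (cover u y (y≢u ∘ sym) Guy))
  ... | true  | false = contradiction same λ ()
  ... | false | true  = contradiction same λ ()

  two-H-colours : 5 ≤ n → ∃[ c₁ ] ∃[ c₂ ] c₁ ≢ c₂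
  two-H-colours 5≤n =
    let t , t-injective , t≢u , t≢v = three-outside 5≤n u≢v
        i , j , i≢j , same-side = bool-pigeonhole (adj G u ∘ t)
    in g (t i) , g (t j) ,
       same-side⇒distinct-H-colours (t-injective i≢j) (t≢u i) (t≢v i) (t≢u j) (t≢v j) same-side

  refine : Fin b → Fin b → Fin n → Fin (a * b)
  refine c₁ c₂ w = combine (f w) (if adj G u w then c₁ else c₂)

  refine-injective : ∀ {c₁ c₂} → c₁ ≢ c₂ → ∀ {w w'} → refine c₁ c₂ w ≡ refine c₁ c₂ w' → w ≡ w'
  refine-injective c₁≢c₂ {w} {w'} eq with w ≟ w'
  ... | yes w≡w' = w≡w'
  ... | no w≢w' =
    let fw≡fw' , labels≡ = combine-injective (f w) _ (f w') _ eq
    in ⊥-elim (same-colour⇒separated-by-u w≢w' fw≡fw' (if-injective c₁≢c₂ labels≡))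

  bound : 5 ≤ n → n ≤ a * b
  bound 5≤n = let c₁ , c₂ , c₁≢c₂ = two-H-colours 5≤n in injective⇒≤ (refine-injective c₁≢c₂)

colour-pair-collision : ∀ {n a b} (f : Fin n → Fin a) (g : Fin n → Fin b) → ¬ n ≤ a * b
  → ∃[ u ] ∃[ v ] u ≢ v × f u ≡ f v × g u ≡ g v
colour-pair-collision f g n≰ab with pigeonhole (≰⇒> n≰ab) (λ w → combine (f w) (g w))
... | u , v , u<v , eq =
  let fu≡fv , gu≡gv = combine-injective (f u) (g u) (f v) (g v) eq
  in u , v , <⇒≢ u<v , fu≡fv , gu≡gv

lower-bound : ∀ {n a b} → 5 ≤ n → (G H : Graph n) → Covers G H → Covers H G
  → HasInjectiveColoring G a → HasInjectiveColoring H b → n ≤ a * b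
lower-bound {n} {a} {b} 5≤n G H G-H H-G (f , f-ok) (g , g-ok) with n ≤? a * b
... | yes n≤ab = n≤ab
... | no n≰ab with colour-pair-collision f g n≰ab
...   | u , v , u≢v , fu≡fv , gu≡gv with adj G u v in Guv
...     | true  = AdjacentTwins.bound G H G-H f-ok g-ok u≢v Guv
                    (same-colour⇒no-common-neighbour {G = G} f-ok u≢v fu≡fv)
                    (same-colour⇒no-common-neighbour {G = H} g-ok u≢v gu≡gv) 5≤n
...     | false = ≤-trans
                    (AdjacentTwins.bound H G H-G g-ok f-ok u≢v (G-H u v u≢v Guv)
                      (same-colour⇒no-common-neighbour {G = H} g-ok u≢v gu≡gv)
                      (same-colour⇒no-common-neighbour {G = G} f-ok u≢v fu≡fv) 5≤n)
                    (≤-reflexive (*-comm b a))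

theorem7 : (n : ℕ) → 5 ≤ n → (G : Graph n) → (a b : ℕ)
    → IsInjectiveChromaticNumber G a
    → IsInjectiveChromaticNumber (complement G) b
    → (n ≤ a * b) × (a * b ≤ n * n)
theorem7 n 5≤n G a b (colouring-G , minimal-G) (colouring-Ḡ , minimal-Ḡ) =
  lower-bound 5≤n G (complement G) (complement-covers G) (covers-complement G) colouring-G colouring-Ḡ ,
  *-mono-≤ (minimal-G n (identity-colouring G)) (minimal-Ḡ n (identity-colouring (complement G)))
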